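{- Let $\mathcal D$ be a staircase diagram on a graph $\Gamma$ with vertex set $S$. Then: (a) $\mathcal D_J:=\{B\in\mathcal D: J\subseteq B\}$ is a chain for every $J\subseteq S$; (b) if $B,B'\in\mathcal D$ with $B\neq B'$, then $B\not\subseteq B'$; (c) if $B,B'\in\mathcal D$ either contain a common element or are adjacent, then $B$ and $B'$ are comparable in the partial order on $\mathcal D$.
   Context: $\Gamma$ is a graph without loops (multiple edges allowed) with vertex set $S$; write $s\sim t$ if $s,t$ are adjacent. A subset of $S$ is connected if its induced subgraph is connected; two subsets are adjacent if some element of one is adjacent to some element of the other. For a poset, a chain is a totally ordered subset, and a subset $Y$ is saturated if $x'\succ y\succ x$ with $x,x'\in Y$ implies $y\in Y$. A staircase diagram on $\Gamma$ is a partially ordered set $(\mathcal D,\preceq)$ of nonempty subsets of $S$ (called blocks), such that: (1) every block is connected, and if $B$ covers $B'$ then $B\cup B'$ is connected; (2) $\mathcal D_s:=\{B\in\mathcal D: s\in B\}$ is a chain for every $s\in S$; (3) if $s\sim t$ then $\mathcal D_s\cup\mathcal D_t$ is a chain and $\mathcal D_s,\mathcal D_t$ are saturated subchains of it; (4) for every $B\in\mathcal D$ there are $s,s'\in S$ such that $B$ is the minimum element of $\mathcal D_s$ and the maximum element of $\mathcal D_{s'}$. -}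

module Defs where

open import Level using (0ℓ)
open import Data.Nat using (ℕ)
open import Data.Fin using (Fin)
open import Data.Fin.Subset using (Subset; _∈_; _⊆_; _∪_; Nonempty) public
open import Data.Product using (Σ; ∃; _×_; _,_)
open import Data.Sum using (_⊎_)
open import Relation.Nullary using (¬_)
open import Relation.Binary.PropositionalEquality using (_≡_; _≢_)
open import Relation.Binary.Structures using (IsPartialOrder)
open import Function.Definitions using (Injective)

-- A graph without loops on the finite vertex set S = Fin n.
-- (Multiple edges are irrelevant: only the adjacency relation matters.)
record Graph (n : ℕ) : Set₁ where
  field
    _∼_     : Fin n → Fin n → Set
    ∼-sym   : ∀ {s t} → s ∼ t → t ∼ s
    ∼-irrefl : ∀ {s} → ¬ (s ∼ s)

module _ {n : ℕ} (Γ : Graph n) where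
  open Graph Γ

  -- walks inside A (the start vertex is assumed to lie in A)
  data WalkIn (A : Subset n) : Fin n → Fin n → Set where
    stop : ∀ {s} → WalkIn A s s
    step : ∀ {s t u} → s ∼ t → t ∈ A → WalkIn A t u → WalkIn A s u

  Connected : Subset n → Set
  Connected A = ∀ s t → s ∈ A → t ∈ A → WalkIn A s t

  AdjacentSets : Subset n → Subset n → Set
  AdjacentSets A B = ∃ λ s → ∃ λ t → s ∈ A × t ∈ B × s ∼ t

module _ {m : ℕ} (_≼_ : Fin m → Fin m → Set) where

  _≺_ : Fin m → Fin m → Set
  x ≺ y = x ≼ y × x ≢ y

  Covers : Fin m → Fin m → Set
  Covers y x = x ≺ y × (∀ z → ¬ (x ≺ z × z ≺ y))

  IsChain : (Fin m → Set) → Set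
  IsChain P = ∀ x y → P x → P y → (x ≼ y ⊎ y ≼ x)

  SaturatedIn : (Y X : Fin m → Set) → Set
  SaturatedIn Y X = ∀ x y x' → Y x → Y x' → X y → x ≺ y → y ≺ x' → Y y

  IsMin IsMax : Fin m → (Fin m → Set) → Set
  IsMin x P = P x × (∀ y → P y → x ≼ y)
  IsMax x P = P x × (∀ y → P y → y ≼ x)

-- A staircase diagram on Γ: a poset of blocks, indexed by Fin m via the
-- injective map blk (so distinct indices = distinct subsets of S).
record StaircaseDiagram {n : ℕ} (Γ : Graph n) : Set₁ where
  open Graph Γ
  field
    m     : ℕ
    blk   : Fin m → Subset n
    blk-inj : Injective _≡_ _≡_ blk
    _≼_   : Fin m → Fin m → Set
    isPartialOrder : IsPartialOrder _≡_ _≼_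
    nonempty : ∀ B → Nonempty (blk B)

  D : Fin n → Fin m → Set
  D s B = s ∈ blk B

  field
    blk-connected : ∀ B → Connected Γ (blk B)
    cover-connected : ∀ B B' → Covers _≼_ B B' → Connected Γ (blk B ∪ blk B')
    D-chain : ∀ s → IsChain _≼_ (D s)
    adj-chain : ∀ s t → s ∼ t → IsChain _≼_ (λ B → D s B ⊎ D t B)
    adj-satˡ : ∀ s t → s ∼ t → SaturatedIn _≼_ (D s) (λ B → D s B ⊎ D t B)
    adj-satʳ : ∀ s t → s ∼ t → SaturatedIn _≼_ (D t) (λ B → D s B ⊎ D t B)
    minmax : ∀ B → ∃ λ s → ∃ λ s' → IsMin _≼_ B (D s) × IsMax _≼_ B (D s')

{-# OPTIONS --safe #-}
module Submission where

open import Defs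
open import Data.Nat using (ℕ)
open import Data.Fin using (Fin)
open import Data.Product using (∃; _×_; _,_; proj₁)
open import Data.Sum using (_⊎_; inj₁; inj₂)
open import Relation.Binary.Structures using (IsPartialOrder)
open import Relation.Nullary using (¬_)
open import Relation.Binary.PropositionalEquality using (_≡_; _≢_)

module _ {m : ℕ} {_≼_ : Fin m → Fin m → Set} (isPartialOrder : IsPartialOrder _≡_ _≼_) where
  open IsPartialOrder isPartialOrder using (antisym)

  min-max-unique : ∀ {x y P Q} → IsMin _≼_ x P → IsMax _≼_ x Q → P y → Q y → x ≡ y
  min-max-unique (_ , x≼P) (_ , Q≼x) Py Qy = antisym (x≼P _ Py) (Q≼x _ Qy)

module _ {n : ℕ} {Γ : Graph n} (𝒟 : StaircaseDiagram Γ) where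
  open StaircaseDiagram 𝒟

  superset-chain : ∀ J → Nonempty J → IsChain _≼_ (λ B → J ⊆ blk B)
  superset-chain J (s , s∈J) B B' J⊆B J⊆B' = D-chain s B B' (J⊆B s∈J) (J⊆B' s∈J)

  blk-⊆⇒≡ : ∀ {B B'} → blk B ⊆ blk B' → B ≡ B'
  blk-⊆⇒≡ {B} B⊆B' with minmax B
  ... | s , s' , B-min , B-max =
    min-max-unique isPartialOrder B-min B-max (B⊆B' (proj₁ B-min)) (B⊆B' (proj₁ B-max))

  overlapping-comparable : ∀ {B B' s} → s ∈ blk B → s ∈ blk B' → B ≼ B' ⊎ B' ≼ B
  overlapping-comparable {B} {B'} {s} = D-chain s B B'

  adjacent-comparable : ∀ {B B'} → AdjacentSets Γ (blk B) (blk B') → B ≼ B' ⊎ B' ≼ B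
  adjacent-comparable {B} {B'} (s , t , s∈B , t∈B' , s∼t) =
    adj-chain s t s∼t B B' (inj₁ s∈B) (inj₂ t∈B')

lemma2p6 : ∀ {n} (Γ : Graph n) (𝒟 : StaircaseDiagram Γ) →
    let open StaircaseDiagram 𝒟 in
    (∀ (J : Subset n) → Nonempty J → IsChain _≼_ (λ B → J ⊆ blk B))
    × (∀ B B' → B ≢ B' → ¬ (blk B ⊆ blk B'))
    × (∀ B B' → ((∃ λ s → s ∈ blk B × s ∈ blk B') ⊎ AdjacentSets Γ (blk B) (blk B'))
         → (B ≼ B' ⊎ B' ≼ B))
lemma2p6 Γ 𝒟 =
    superset-chain 𝒟
  , (λ B B' B≢B' B⊆B' → B≢B' (blk-⊆⇒≡ 𝒟 B⊆B'))
  , λ where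
      B B' (inj₁ (s , s∈B , s∈B')) → overlapping-comparable 𝒟 s∈B s∈B'
      B B' (inj₂ adjacent) → adjacent-comparable 𝒟 adjacent
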